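{- Let $k\geqslant 1$ and $m\geqslant 1$ be integers with $m\not\equiv 0\pmod k$, and let $n=km$. Then $$\mathbb{Z}/n\mathbb{Z}=\bigcup_{h\in\mathbb{Z}/n\mathbb{Z},\ h\not\equiv 0\ (\mathrm{mod}\ k)}\{h,kh\}.$$
   Context: Since $k\mid n$, the condition $h\not\equiv 0 \pmod k$ is well defined for $h\in\mathbb{Z}/n\mathbb{Z}$. -}

module Defs where

open import Data.Nat using (ℕ; _*_; _%_; NonZero)
open import Data.Nat.DivMod using (m%n<n)
open import Data.Fin using (Fin; toℕ; fromℕ<)

-- Z/nZ is modelled as Fin n (canonical representatives 0..n-1).
-- Multiplication of a residue class by an integer k in Z/nZ.
scale : (n : ℕ) .{{_ : NonZero n}} → ℕ → Fin n → Fin n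
scale n k h = fromℕ< (m%n<n (k * toℕ h) n)

{-# OPTIONS --safe #-}
module Submission where

-- A non-multiple x of k is its own witness. A multiple x = k j with j < m is the image of
-- j under h ↦ k h when k ∤ j; otherwise it is the image of j + m, since k (j + m) = k j + n
-- and k ∤ j + m because k ∤ m. Both witnesses lie below n because k ≥ 2.

open import Defs
open import Data.Nat using (ℕ; suc; _+_; _*_; _≥_; _<_; _≤_; _%_; NonZero; s≤s; z≤n)
open import Data.Nat.Properties
  using (*-comm; *-distribˡ-+; *-monoˡ-≤; *-cancelˡ-<; +-monoˡ-<; +-identityʳ; m≤m+n; <-≤-trans; ≤-trans)
open import Data.Nat.DivMod using (m<n⇒m%n≡m; [m+n]%n≡m%n)
open import Data.Nat.Divisibility using (_∣_; _∣?_; divides; ∣m+n∣m⇒∣n; 1∣_)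
open import Data.Fin using (Fin; toℕ; fromℕ<)
open import Data.Fin.Properties using (toℕ-fromℕ<; toℕ-injective; toℕ<n)
open import Data.Product using (Σ; _×_; _,_; ∃-syntax)
open import Data.Sum using (_⊎_; inj₁; inj₂)
open import Data.Empty using (⊥-elim)
open import Function using (_∘_)
open import Relation.Nullary using (¬_; Dec; yes; no)
open import Relation.Binary.PropositionalEquality using (_≡_; refl; sym; trans; cong; subst; module ≡-Reasoning)

open ≡-Reasoning

toℕ-scale-fromℕ< : ∀ {n} .{{_ : NonZero n}} k {y} (y<n : y < n) →
                   toℕ (scale n k (fromℕ< y<n)) ≡ (k * y) % n
toℕ-scale-fromℕ< {n} k {y} y<n = begin
  toℕ (scale n k (fromℕ< y<n))  ≡⟨ toℕ-fromℕ< _ ⟩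
  (k * toℕ (fromℕ< y<n)) % n    ≡⟨ cong (λ z → (k * z) % n) (toℕ-fromℕ< y<n) ⟩
  (k * y) % n                   ∎

1≤∧∤⇒2≤ : ∀ {k m} → 1 ≤ k → ¬ (k ∣ m) → 2 ≤ k
1≤∧∤⇒2≤ {suc 0}       {m} _ k∤m = ⊥-elim (k∤m (1∣ m))
1≤∧∤⇒2≤ {suc (suc _)}     _ _   = s≤s (s≤s z≤n)

m+m≤k*m : ∀ {k} m → 2 ≤ k → m + m ≤ k * m
m+m≤k*m {k} m 2≤k = subst (_≤ k * m) (cong (m +_) (+-identityʳ m)) (*-monoˡ-≤ m 2≤k)

[k*[j+m]]%[k*m]≡[k*j]%[k*m] : ∀ k j m .{{_ : NonZero (k * m)}} →
                              (k * (j + m)) % (k * m) ≡ (k * j) % (k * m)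
[k*[j+m]]%[k*m]≡[k*j]%[k*m] k j m = begin
  (k * (j + m)) % (k * m)    ≡⟨ cong (_% (k * m)) (*-distribˡ-+ k j m) ⟩
  (k * j + k * m) % (k * m)  ≡⟨ [m+n]%n≡m%n (k * j) (k * m) ⟩
  (k * j) % (k * m)          ∎

multiple-has-nonmultiple-root : ∀ {k m j} .{{_ : NonZero (k * m)}} → 2 ≤ k → ¬ (k ∣ m) →
  k * j < k * m → ∃[ y ] (y < k * m × ¬ (k ∣ y) × (k * y) % (k * m) ≡ k * j)
multiple-has-nonmultiple-root {k} {m} {j} 2≤k k∤m kj<km = root (k ∣? j)
  where
    j<m : j < m
    j<m = *-cancelˡ-< k j m kj<km
    kj%km≡kj : (k * j) % (k * m) ≡ k * j
    kj%km≡kj = m<n⇒m%n≡m kj<km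
    root : Dec (k ∣ j) → ∃[ y ] (y < k * m × ¬ (k ∣ y) × (k * y) % (k * m) ≡ k * j)
    root (no k∤j)  = j , <-≤-trans j<m (≤-trans (m≤m+n m m) (m+m≤k*m m 2≤k)) , k∤j , kj%km≡kj
    root (yes k∣j) = j + m , <-≤-trans (+-monoˡ-< m j<m) (m+m≤k*m m 2≤k)
                   , (λ k∣j+m → k∤m (∣m+n∣m⇒∣n k∣j+m k∣j))
                   , trans ([k*[j+m]]%[k*m]≡[k*j]%[k*m] k j m) kj%km≡kj

lemma5 : (k m : ℕ) → k ≥ 1 → m ≥ 1 → ¬ (k ∣ m) →
    (n : ℕ) → n ≡ k * m → .{{_ : NonZero n}} →
    (x : Fin n) →
      Σ (Fin n) (λ h → ¬ (k ∣ toℕ h) × (x ≡ h ⊎ x ≡ scale n k h))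
lemma5 k m k≥1 _ k∤m .(k * m) refl x with k ∣? toℕ x
... | no k∤x = x , k∤x , inj₁ refl
... | yes (divides j x≡j*k) =
  let y , y<n , k∤y , ky%n≡kj = multiple-has-nonmultiple-root (1≤∧∤⇒2≤ k≥1 k∤m) k∤m kj<km
  in fromℕ< y<n , k∤y ∘ subst (k ∣_) (toℕ-fromℕ< y<n)
   , inj₂ (toℕ-injective (trans x≡k*j (trans (sym ky%n≡kj) (sym (toℕ-scale-fromℕ< k y<n)))))
  where
    x≡k*j : toℕ x ≡ k * j
    x≡k*j = trans x≡j*k (*-comm j k)
    kj<km : k * j < k * m
    kj<km = subst (_< k * m) x≡k*j (toℕ<n x)
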